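{- Let $m$ be a positive integer and let $L$ be a list assignment on a path $P=v_1\cdots v_n$ with $n$ odd and $|L(v_i)|=4m$ for all $i$. Then \[ S_L(P) = 2nm-2m+\sum_{\substack{k \text{ even}\\ k<n}} |X_{k-1}\setminus L(v_k)| + |X_n|. \]
   Context: $X_1=L(v_1)$, $X_i=L(v_i)\setminus X_{i-1}$ for $i>1$, and $S_L(P)=\sum_{i=1}^n|X_i|$. -}

module Defs where

open import Data.Nat using (ℕ; zero; suc; _+_; _*_)
open import Data.Fin.Subset using (Subset; ⊥; _─_; ∣_∣)

-- A list assignment on the path v₁ ⋯ vₙ with colours drawn from a finite
-- palette Fin c: vertex vᵢ is represented by the index i (1 ≤ i ≤ n);
-- the value at 0 and at indices > n is irrelevant.
ListAssignment : ℕ → Set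
ListAssignment c = ℕ → Subset c

-- X i as in the paper: X₁ = L(v₁), Xᵢ = L(vᵢ) ∖ Xᵢ₋₁ (X₀ := ⊥ = ∅ as a convenience,
-- so that X₁ = L(v₁) ∖ ∅ = L(v₁)).
X : ∀ {c} → ListAssignment c → ℕ → Subset c
X L zero    = ⊥
X L (suc i) = L (suc i) ─ X L i

S : ∀ {c} → ListAssignment c → ℕ → ℕ
S L zero    = 0
S L (suc i) = S L i + ∣ X L (suc i) ∣

-- Σ over even k with 2 ≤ k ≤ 2t of |X_{k-1} ∖ L(v_k)|
-- (for n = 2t+1 these are exactly the even k < n)
evenSum : ∀ {c} → ListAssignment c → ℕ → ℕ
evenSum L zero    = 0
evenSum L (suc t) = evenSum L t + ∣ X L (1 + 2 * t) ─ L (2 + 2 * t) ∣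

-- Since Xₖ₊₁ = L(vₖ₊₁) ∖ Xₖ, each consecutive pair satisfies
-- |Xₖ| + |Xₖ₊₁| = |Xₖ ∪ L(vₖ₊₁)| = |L(vₖ₊₁)| + |Xₖ ∖ L(vₖ₊₁)|.
-- Grouping S_L(P) for n = 2t + 1 as (|X₁| + |X₂|) + ⋯ + (|X₂ₜ₋₁| + |X₂ₜ|) + |Xₙ|,
-- every even vertex contributes 4m plus one term of the even sum, and
-- 4mt = 2nm − 2m.
module Submission where

open import Defs
open import Data.Nat using (ℕ; zero; suc; _+_; _*_; _∸_; _≤_; _<_; _%_; _/_; s≤s; z≤n)
open import Data.Nat.Properties
  using (+-suc; +-assoc; *-suc; *-comm; *-monoʳ-<; m+n∸m≡n; n<1+n; m<n⇒m<1+n)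
open import Data.Nat.DivMod using (m≡m%n+[m/n]*n)
open import Data.Nat.Tactic.RingSolver using (solve-∀)
open import Data.Fin.Subset using (Subset; ∣_∣; _─_; _∪_; inside; outside)
open import Data.Fin.Subset.Properties using (∪-comm)
open import Data.Vec using ([]; _∷_)
open import Relation.Binary.PropositionalEquality
open ≡-Reasoning

∣p∣+∣q─p∣≡∣p∪q∣ : ∀ {c} (p q : Subset c) → ∣ p ∣ + ∣ q ─ p ∣ ≡ ∣ p ∪ q ∣
∣p∣+∣q─p∣≡∣p∪q∣ []            []            = refl
∣p∣+∣q─p∣≡∣p∪q∣ (outside ∷ p) (outside ∷ q) = ∣p∣+∣q─p∣≡∣p∪q∣ p q
∣p∣+∣q─p∣≡∣p∪q∣ (outside ∷ p) (inside ∷ q)  = trans (+-suc ∣ p ∣ _) (cong suc (∣p∣+∣q─p∣≡∣p∪q∣ p q))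
∣p∣+∣q─p∣≡∣p∪q∣ (inside ∷ p)  (outside ∷ q) = cong suc (∣p∣+∣q─p∣≡∣p∪q∣ p q)
∣p∣+∣q─p∣≡∣p∪q∣ (inside ∷ p)  (inside ∷ q)  = cong suc (∣p∣+∣q─p∣≡∣p∪q∣ p q)

∣p∣+∣q─p∣≡∣q∣+∣p─q∣ : ∀ {c} (p q : Subset c) → ∣ p ∣ + ∣ q ─ p ∣ ≡ ∣ q ∣ + ∣ p ─ q ∣
∣p∣+∣q─p∣≡∣q∣+∣p─q∣ p q = begin
  ∣ p ∣ + ∣ q ─ p ∣ ≡⟨ ∣p∣+∣q─p∣≡∣p∪q∣ p q ⟩
  ∣ p ∪ q ∣         ≡⟨ cong ∣_∣ (∪-comm p q) ⟩
  ∣ q ∪ p ∣         ≡⟨ ∣p∣+∣q─p∣≡∣p∪q∣ q p ⟨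
  ∣ q ∣ + ∣ p ─ q ∣ ∎

∣X[1+k]∣+∣X[2+k]∣ : ∀ {c} (L : ListAssignment c) k →
                    ∣ X L (suc k) ∣ + ∣ X L (2 + k) ∣ ≡ ∣ L (2 + k) ∣ + ∣ X L (suc k) ─ L (2 + k) ∣
∣X[1+k]∣+∣X[2+k]∣ L k = ∣p∣+∣q─p∣≡∣q∣+∣p─q∣ (X L (suc k)) (L (2 + k))

S-odd : ∀ {c} (L : ListAssignment c) (d t : ℕ) →
        (∀ j → j < t → ∣ L (2 + 2 * j) ∣ ≡ d) →
        S L (1 + 2 * t) ≡ t * d + evenSum L t + ∣ X L (1 + 2 * t) ∣
S-odd L d zero    _ = refl
S-odd {c} L d (suc t) even-size = begin
  S L (1 + 2 * suc t)
    ≡⟨ cong (λ k → S L (suc k)) (*-suc 2 t) ⟩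
  S L (1 + 2 * t) + ∣ X L (2 + 2 * t) ∣ + ∣ X L (3 + 2 * t) ∣
    ≡⟨ cong (λ s → s + ∣ X L (2 + 2 * t) ∣ + ∣ X L (3 + 2 * t) ∣) (S-odd L d t (λ j j<t → even-size j (m<n⇒m<1+n j<t))) ⟩
  t * d + evenSum L t + ∣ X L (1 + 2 * t) ∣ + ∣ X L (2 + 2 * t) ∣ + ∣ X L (3 + 2 * t) ∣
    ≡⟨ cong (_+ ∣ X L (3 + 2 * t) ∣) (+-assoc (t * d + evenSum L t) _ _) ⟩
  t * d + evenSum L t + (∣ X L (1 + 2 * t) ∣ + ∣ X L (2 + 2 * t) ∣) + ∣ X L (3 + 2 * t) ∣
    ≡⟨ cong (λ s → t * d + evenSum L t + s + ∣ X L (3 + 2 * t) ∣) (∣X[1+k]∣+∣X[2+k]∣ L (2 * t)) ⟩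
  t * d + evenSum L t + (∣ L (2 + 2 * t) ∣ + ∣ A ∣) + ∣ X L (3 + 2 * t) ∣
    ≡⟨ cong (λ s → t * d + evenSum L t + (s + ∣ A ∣) + ∣ X L (3 + 2 * t) ∣) (even-size t (n<1+n t)) ⟩
  t * d + evenSum L t + (d + ∣ A ∣) + ∣ X L (3 + 2 * t) ∣
    ≡⟨ cong (_+ ∣ X L (3 + 2 * t) ∣) (regroup d (t * d) (evenSum L t) ∣ A ∣) ⟩
  suc t * d + (evenSum L t + ∣ A ∣) + ∣ X L (3 + 2 * t) ∣
    ≡⟨ cong (λ k → suc t * d + evenSum L (suc t) + ∣ X L (suc k) ∣) (*-suc 2 t) ⟨
  suc t * d + evenSum L (suc t) + ∣ X L (1 + 2 * suc t) ∣ ∎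
  where
  A : Subset c
  A = X L (1 + 2 * t) ─ L (2 + 2 * t)
  regroup : ∀ x y z w → y + z + (x + w) ≡ x + y + (z + w)
  regroup = solve-∀

odd⇒1+2*[n/2] : ∀ n → n % 2 ≡ 1 → n ≡ 1 + 2 * (n / 2)
odd⇒1+2*[n/2] n n%2≡1 = begin
  n                   ≡⟨ m≡m%n+[m/n]*n n 2 ⟩
  n % 2 + n / 2 * 2   ≡⟨ cong₂ _+_ n%2≡1 (*-comm (n / 2) 2) ⟩
  1 + 2 * (n / 2)     ∎

2+2*j≤1+2*t : ∀ {j t} → j < t → 2 + 2 * j ≤ 1 + 2 * t
2+2*j≤1+2*t j<t = s≤s (*-monoʳ-< 2 j<t)

2*[1+2*t]*m∸2*m≡t*[4*m] : ∀ t m → 2 * (1 + 2 * t) * m ∸ 2 * m ≡ t * (4 * m)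
2*[1+2*t]*m∸2*m≡t*[4*m] t m = begin
  2 * (1 + 2 * t) * m ∸ 2 * m     ≡⟨ cong (_∸ 2 * m) (expand t m) ⟩
  2 * m + t * (4 * m) ∸ 2 * m     ≡⟨ m+n∸m≡n (2 * m) (t * (4 * m)) ⟩
  t * (4 * m)                     ∎
  where
  expand : ∀ t m → 2 * (1 + 2 * t) * m ≡ 2 * m + t * (4 * m)
  expand = solve-∀

lemma3p1 : (c m n : ℕ) → 1 ≤ m → n % 2 ≡ 1 → (L : ListAssignment c) →
           (∀ i → 1 ≤ i → i ≤ n → ∣ L i ∣ ≡ 4 * m) →
           S L n ≡ 2 * n * m ∸ 2 * m + evenSum L (n / 2) + ∣ X L n ∣
lemma3p1 c m n _ n%2≡1 L size =
  subst (λ k → S L k ≡ 2 * k * m ∸ 2 * m + evenSum L t + ∣ X L k ∣) (sym n≡1+2t) odd-case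
  where
  t = n / 2
  n≡1+2t = odd⇒1+2*[n/2] n n%2≡1
  even-size : ∀ j → j < t → ∣ L (2 + 2 * j) ∣ ≡ 4 * m
  even-size j j<t = size (2 + 2 * j) (s≤s z≤n) (subst (2 + 2 * j ≤_) (sym n≡1+2t) (2+2*j≤1+2*t j<t))
  odd-case : S L (1 + 2 * t) ≡ 2 * (1 + 2 * t) * m ∸ 2 * m + evenSum L t + ∣ X L (1 + 2 * t) ∣
  odd-case = begin
    S L (1 + 2 * t)
      ≡⟨ S-odd L (4 * m) t even-size ⟩
    t * (4 * m) + evenSum L t + ∣ X L (1 + 2 * t) ∣
      ≡⟨ cong (λ a → a + evenSum L t + ∣ X L (1 + 2 * t) ∣) (2*[1+2*t]*m∸2*m≡t*[4*m] t m) ⟨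
    2 * (1 + 2 * t) * m ∸ 2 * m + evenSum L t + ∣ X L (1 + 2 * t) ∣ ∎
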